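{- Let $\bm\lambda=(R_1,\dots,R_n)$ be a horizontal-strip with $i<j$, $l(R_i)<l(R_j)$ and $R_i\nleftrightarrow R_j$. Suppose that $R_i\nleftrightarrow R_k$ and $R_j\nleftrightarrow R_k$ for some $k$ with $k<i$ or $k>j$. Then the pair $(R_i,R_j)$ is strict.
   Context: A row is $R=a/b=\{(1,j):b+1\le j\le a\}$ ($a\ge b\ge0$ integers); $l(R)=b$, $|R|$ its number of cells, $R^+=(a+1)/(b+1)$. For rows $R,R'$: $M(R,R')=|R\cap R'|$ if $l(R)\le l(R')$, else $|R\cap R'^+|$. Rows commute, $R\leftrightarrow R'$, if $M(R,R')=M(R',R)$, else $R\nleftrightarrow R'$. For a horizontal-strip (sequence of rows) $(R_1,\dots,R_n)$, $M_{i,j}=M(R_{\min(i,j)},R_{\max(i,j)})$ for $i\ne j$. A pair $(R_i,R_j)$ with $i<j$ and $l(R_i)<l(R_j)$ is strict if either $0<M_{i,j}<\min\{|R_i|,|R_j|\}$, or $M_{i,j}=0$ and $M_{i,k}+M_{j,k}\ge|R_k|+1$ for some index $k\notin\{i,j\}$. -}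

module Defs where

open import Data.Nat using (ℕ; _+_; _∸_; _≤_; _<_; _⊔_; _⊓_; _≤ᵇ_)
open import Data.Bool using (if_then_else_)
open import Data.Fin using (Fin; toℕ)
import Data.Fin as F
open import Data.Product using (_×_; ∃-syntax)
open import Data.Sum using (_⊎_)
open import Relation.Binary.PropositionalEquality using (_≡_; _≢_)
open import Relation.Nullary using (¬_)

-- A row a/b = {(1,j) : b+1 ≤ j ≤ a}, with a ≥ b ≥ 0.
record Row : Set where
  constructor _/_⟨_⟩
  field
    a   : ℕ
    b   : ℕ
    b≤a : b ≤ a
open Row public

l : Row → ℕ
l R = b R

∣_∣ʳ : Row → ℕ
∣ R ∣ʳ = a R ∸ b R

_⁺ : Row → Row
(x / y ⟨ p ⟩) ⁺ = Data.Nat.suc x / Data.Nat.suc y ⟨ Data.Nat.s≤s p ⟩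

-- |R ∩ R'| : the two sets of columns are the intervals (b,a] and (b',a'],
-- so the intersection has  min(a,a') - max(b,b')  cells (truncated at 0).
∣_∩_∣ : Row → Row → ℕ
∣ R ∩ R' ∣ = (a R ⊓ a R') ∸ (b R ⊔ b R')

M : Row → Row → ℕ
M R R' = if l R ≤ᵇ l R' then ∣ R ∩ R' ∣ else ∣ R ∩ (R' ⁺) ∣

_↔ʳ_ : Row → Row → Set
R ↔ʳ R' = M R R' ≡ M R' R

HStrip : ℕ → Set
HStrip n = Fin n → Row

Mᵢⱼ : ∀ {n} → HStrip n → Fin n → Fin n → ℕ
Mᵢⱼ λs i j = if toℕ i ≤ᵇ toℕ j then M (λs i) (λs j) else M (λs j) (λs i)

Strict : ∀ {n} → HStrip n → Fin n → Fin n → Set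
Strict λs i j =
  i F.< j × l (λs i) < l (λs j) ×
  ( (0 < Mᵢⱼ λs i j × Mᵢⱼ λs i j < ∣ λs i ∣ʳ ⊓ ∣ λs j ∣ʳ)
  ⊎ (Mᵢⱼ λs i j ≡ 0 ×
     ∃[ k ] (k ≢ i × k ≢ j × ∣ λs k ∣ʳ + 1 ≤ Mᵢⱼ λs i k + Mᵢⱼ λs j k)) )

{-# OPTIONS --safe #-}
-- Two rows of different lengths fail to commute exactly when they interlace,
-- b < b' ≤ a < a', and then M of the pair is their overlap a − b'.  If that
-- overlap is nonempty, it is strictly smaller than both rows.  If it is empty,
-- the rows touch (a = b'), and a row R_k failing to commute with both is forced
-- to straddle the touching point: b < b_k < b' < a_k < a'.  Outside the pair,
-- M(R_k, ·) measures one side of the split of R_k at b' and the other side plus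
-- one cell, so M_{i,k} + M_{j,k} = |R_k| + 1.
module Submission where

open import Defs
open import Data.Nat using (ℕ; _<_; suc; _≤_; _∸_; _+_; _⊓_; _⊔_; _≤ᵇ_; z≤n; s≤s)
open import Data.Nat.Properties
open import Data.Bool using (true; false; if_then_else_)
open import Data.Fin using (Fin)
import Data.Fin as F
import Data.Fin.Properties as Fin
open import Data.Product using (_×_; _,_; proj₁; proj₂)
open import Data.Sum using (_⊎_; inj₁; inj₂)
open import Data.Empty using (⊥-elim)
open import Relation.Nullary using (¬_; yes; no)
open import Relation.Binary using (tri<; tri≈; tri>)
open import Relation.Binary.PropositionalEquality

if-≤ᵇ-then : ∀ {A : Set} {m n} {x y : A} → m ≤ n → (if m ≤ᵇ n then x else y) ≡ x
if-≤ᵇ-then {m = m} {n} m≤n with m ≤ᵇ n | ≤⇒≤ᵇ {m} {n} m≤n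
... | true | _ = refl

if-≤ᵇ-else : ∀ {A : Set} {m n} {x y : A} → n < m → (if m ≤ᵇ n then x else y) ≡ y
if-≤ᵇ-else {m = m} {n} n<m with m ≤ᵇ n | ≤ᵇ⇒≤ m n
... | false | _ = refl
... | true | m≤n = ⊥-elim (<⇒≱ n<m (m≤n _))

∸-telescope : ∀ {x y z} → x ≤ y → y ≤ z → (y ∸ x) + (z ∸ y) ≡ z ∸ x
∸-telescope z≤n z≤n = refl
∸-telescope z≤n (s≤s y≤z) = cong suc (∸-telescope z≤n y≤z)
∸-telescope (s≤s x≤y) (s≤s y≤z) = ∸-telescope x≤y y≤z

M-of-< : ∀ R S → l R < l S → M R S ≡ a R ⊓ a S ∸ b S
M-of-< R S lR<lS =
  trans (if-≤ᵇ-then (<⇒≤ lR<lS)) (cong (a R ⊓ a S ∸_) (m≤n⇒m⊔n≡n (<⇒≤ lR<lS)))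

M-of-> : ∀ R S → l S < l R → M R S ≡ a R ⊓ suc (a S) ∸ b R
M-of-> R S lS<lR =
  trans (if-≤ᵇ-else lS<lR) (cong (a R ⊓ suc (a S) ∸_) (m≥n⇒m⊔n≡m lS<lR))

↔ʳ-of-≡ : ∀ R S → l R ≡ l S → R ↔ʳ S
↔ʳ-of-≡ R S lR≡lS rewrite lR≡lS =
  trans (if-≤ᵇ-then (≤-refl {b S}))
        (trans (cong (_∸ (b S ⊔ b S)) (⊓-comm (a R) (a S))) (sym (if-≤ᵇ-then (≤-refl {b S}))))

record Interlaced (R S : Row) : Set where
  constructor interlaced
  field
    starts-before : b R < b S
    overlaps      : b S ≤ a R
    ends-before   : a R < a S

interlaced-M : ∀ {R S} → Interlaced R S → M R S ≡ a R ∸ b S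
interlaced-M {R} {S} (interlaced lR<lS _ aR<aS) =
  trans (M-of-< R S lR<lS) (cong (_∸ b S) (m≤n⇒m⊓n≡m (<⇒≤ aR<aS)))

interlaced-M-flip : ∀ {R S} → Interlaced R S → M S R ≡ suc (a R) ∸ b S
interlaced-M-flip {R} {S} (interlaced lR<lS _ aR<aS) =
  trans (M-of-> S R lR<lS) (cong (_∸ b S) (m≥n⇒m⊓n≡n aR<aS))

↮⇒interlaced : ∀ R S → l R < l S → ¬ R ↔ʳ S → Interlaced R S
↮⇒interlaced R S lR<lS R↮S with ≤-<-connex (a S) (a R)
... | inj₁ aS≤aR = ⊥-elim (R↮S (begin
      M R S                  ≡⟨ M-of-< R S lR<lS ⟩
      a R ⊓ a S ∸ b S        ≡⟨ cong (_∸ b S) (m≥n⇒m⊓n≡n aS≤aR) ⟩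
      a S ∸ b S              ≡⟨ cong (_∸ b S) (m≤n⇒m⊓n≡m (m≤n⇒m≤1+n aS≤aR)) ⟨
      a S ⊓ suc (a R) ∸ b S  ≡⟨ M-of-> S R lR<lS ⟨
      M S R                  ∎))
  where open ≡-Reasoning
... | inj₂ aR<aS with b S ≤? a R
...   | yes bS≤aR = interlaced lR<lS bS≤aR aR<aS
...   | no bS≰aR = ⊥-elim (R↮S (begin
      M R S                  ≡⟨ M-of-< R S lR<lS ⟩
      a R ⊓ a S ∸ b S        ≡⟨ cong (_∸ b S) (m≤n⇒m⊓n≡m (<⇒≤ aR<aS)) ⟩
      a R ∸ b S              ≡⟨ m≤n⇒m∸n≡0 (<⇒≤ aR<bS) ⟩
      0                      ≡⟨ m≤n⇒m∸n≡0 aR<bS ⟨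
      suc (a R) ∸ b S        ≡⟨ cong (_∸ b S) (m≥n⇒m⊓n≡n aR<aS) ⟨
      a S ⊓ suc (a R) ∸ b S  ≡⟨ M-of-> S R lR<lS ⟨
      M S R                  ∎))
  where
  open ≡-Reasoning
  aR<bS : a R < b S
  aR<bS = ≰⇒> bS≰aR

↮⇒interlaced-either : ∀ R S → ¬ R ↔ʳ S → Interlaced R S ⊎ Interlaced S R
↮⇒interlaced-either R S R↮S with <-cmp (l R) (l S)
... | tri< lR<lS _ _ = inj₁ (↮⇒interlaced R S lR<lS R↮S)
... | tri≈ _ lR≡lS _ = ⊥-elim (R↮S (↔ʳ-of-≡ R S lR≡lS))
... | tri> _ _ lS<lR = inj₂ (↮⇒interlaced S R lS<lR (≢-sym R↮S))

interlaced-overlap-bounds : ∀ {R S} → Interlaced R S → b S < a R →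
                            0 < a R ∸ b S × a R ∸ b S < ∣ R ∣ʳ ⊓ ∣ S ∣ʳ
interlaced-overlap-bounds {R} {S} (interlaced lR<lS _ aR<aS) bS<aR =
  m<n⇒0<n∸m bS<aR ,
  ⊓-glb (∸-monoʳ-< lR<lS (<⇒≤ bS<aR)) (∸-monoˡ-< aR<aS (<⇒≤ bS<aR))

touching-interlaced-squeeze : ∀ {R S T} → Interlaced R S → a R ≡ b S →
                              ¬ R ↔ʳ T → ¬ S ↔ʳ T → Interlaced R T × Interlaced T S
touching-interlaced-squeeze {R} {S} {T} (interlaced lR<lS _ _) touch R↮T S↮T
  with ↮⇒interlaced-either R T R↮T | ↮⇒interlaced-either S T S↮T
... | inj₁ RT | inj₂ TS = RT , TS
... | inj₁ (interlaced _ bT≤aR _) | inj₁ (interlaced lS<lT _ _) =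
  ⊥-elim (<⇒≱ lS<lT (subst (b T ≤_) touch bT≤aR))
... | inj₂ (interlaced lT<lR _ _) | inj₁ (interlaced lS<lT _ _) =
  ⊥-elim (<-asym (<-trans lT<lR lR<lS) lS<lT)
... | inj₂ (interlaced _ _ aT<aR) | inj₂ (interlaced _ bS≤aT _) =
  ⊥-elim (<⇒≱ aT<aR (subst (_≤ a T) (sym touch) bS≤aT))

sum-M-from-straddler : ∀ {R S T} → Interlaced R T → Interlaced T S → a R ≡ b S →
                       M T R + M T S ≡ suc ∣ T ∣ʳ
sum-M-from-straddler {R} {S} {T} RT TS@(interlaced lT<lS bS≤aT _) touch = begin
  M T R + M T S                   ≡⟨ cong₂ _+_ (interlaced-M-flip RT) (interlaced-M TS) ⟩
  suc (a R) ∸ b T + (a T ∸ b S)   ≡⟨ cong (λ x → suc x ∸ b T + (a T ∸ b S)) touch ⟩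
  suc (b S) ∸ b T + (a T ∸ b S)   ≡⟨ cong (_+ (a T ∸ b S)) (+-∸-assoc 1 (<⇒≤ lT<lS)) ⟩
  suc (b S ∸ b T + (a T ∸ b S))   ≡⟨ cong suc (∸-telescope (<⇒≤ lT<lS) bS≤aT) ⟩
  suc (a T ∸ b T)                 ∎
  where open ≡-Reasoning

sum-M-to-straddler : ∀ {R S T} → Interlaced R T → Interlaced T S → a R ≡ b S →
                     M R T + M S T ≡ suc ∣ T ∣ʳ
sum-M-to-straddler {R} {S} {T} RT TS@(interlaced lT<lS bS≤aT _) touch = begin
  M R T + M S T                   ≡⟨ cong₂ _+_ (interlaced-M RT) (interlaced-M-flip TS) ⟩
  a R ∸ b T + (suc (a T) ∸ b S)   ≡⟨ cong₂ (λ x y → x ∸ b T + y) touch (+-∸-assoc 1 bS≤aT) ⟩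
  b S ∸ b T + suc (a T ∸ b S)     ≡⟨ +-suc (b S ∸ b T) (a T ∸ b S) ⟩
  suc (b S ∸ b T + (a T ∸ b S))   ≡⟨ cong suc (∸-telescope (<⇒≤ lT<lS) bS≤aT) ⟩
  suc (a T ∸ b T)                 ∎
  where open ≡-Reasoning

Mᵢⱼ-of-< : ∀ {n} (λs : HStrip n) {i j} → i F.< j → Mᵢⱼ λs i j ≡ M (λs i) (λs j)
Mᵢⱼ-of-< λs i<j = if-≤ᵇ-then (<⇒≤ i<j)

Mᵢⱼ-of-> : ∀ {n} (λs : HStrip n) {i j} → j F.< i → Mᵢⱼ λs i j ≡ M (λs j) (λs i)
Mᵢⱼ-of-> λs j<i = if-≤ᵇ-else j<i

outside-straddler-witness : ∀ {n} (λs : HStrip n) {i j k} → i F.< j → k F.< i ⊎ j F.< k →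
                            Interlaced (λs i) (λs k) → Interlaced (λs k) (λs j) →
                            a (λs i) ≡ b (λs j) →
                            k ≢ i × k ≢ j × ∣ λs k ∣ʳ + 1 ≤ Mᵢⱼ λs i k + Mᵢⱼ λs j k
outside-straddler-witness λs {i} {j} {k} i<j (inj₁ k<i) ik kj touch =
  Fin.<⇒≢ k<i , Fin.<⇒≢ (<-trans k<i i<j) , ≤-reflexive (begin
    ∣ λs k ∣ʳ + 1                        ≡⟨ +-comm _ 1 ⟩
    suc ∣ λs k ∣ʳ                        ≡⟨ sum-M-from-straddler ik kj touch ⟨
    M (λs k) (λs i) + M (λs k) (λs j)   ≡⟨ cong₂ _+_ (Mᵢⱼ-of-> λs k<i)
                                                      (Mᵢⱼ-of-> λs (<-trans k<i i<j)) ⟨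
    Mᵢⱼ λs i k + Mᵢⱼ λs j k             ∎)
  where open ≡-Reasoning
outside-straddler-witness λs {i} {j} {k} i<j (inj₂ j<k) ik kj touch =
  ≢-sym (Fin.<⇒≢ (<-trans i<j j<k)) , ≢-sym (Fin.<⇒≢ j<k) , ≤-reflexive (begin
    ∣ λs k ∣ʳ + 1                        ≡⟨ +-comm _ 1 ⟩
    suc ∣ λs k ∣ʳ                        ≡⟨ sum-M-to-straddler ik kj touch ⟨
    M (λs i) (λs k) + M (λs j) (λs k)   ≡⟨ cong₂ _+_ (Mᵢⱼ-of-< λs (<-trans i<j j<k))
                                                      (Mᵢⱼ-of-< λs j<k) ⟨
    Mᵢⱼ λs i k + Mᵢⱼ λs j k             ∎)
  where open ≡-Reasoning

proposition5p26 : (n : ℕ) (λs : HStrip n) (i j k : Fin n) →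
                  i F.< j → l (λs i) < l (λs j) → ¬ (λs i ↔ʳ λs j) →
                  ¬ (λs i ↔ʳ λs k) → ¬ (λs j ↔ʳ λs k) →
                  (k F.< i ⊎ j F.< k) →
                  Strict λs i j
proposition5p26 n λs i j k i<j li<lj i↮j i↮k j↮k k-outside =
  strictness (m≤n⇒m<n∨m≡n (Interlaced.overlaps ij))
  where
  ij : Interlaced (λs i) (λs j)
  ij = ↮⇒interlaced (λs i) (λs j) li<lj i↮j
  Mᵢⱼ≡overlap : Mᵢⱼ λs i j ≡ a (λs i) ∸ b (λs j)
  Mᵢⱼ≡overlap = trans (Mᵢⱼ-of-< λs i<j) (interlaced-M ij)
  strictness : b (λs j) < a (λs i) ⊎ b (λs j) ≡ a (λs i) → Strict λs i j
  strictness (inj₁ bj<ai) = i<j , li<lj ,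
    inj₁ (subst (λ m → 0 < m × m < ∣ λs i ∣ʳ ⊓ ∣ λs j ∣ʳ) (sym Mᵢⱼ≡overlap)
                (interlaced-overlap-bounds ij bj<ai))
  strictness (inj₂ bj≡ai) = i<j , li<lj ,
    inj₂ (trans Mᵢⱼ≡overlap (m≤n⇒m∸n≡0 (≤-reflexive (sym bj≡ai))) ,
          k , outside-straddler-witness λs i<j k-outside ik kj (sym bj≡ai))
    where
    ik×kj : Interlaced (λs i) (λs k) × Interlaced (λs k) (λs j)
    ik×kj = touching-interlaced-squeeze ij (sym bj≡ai) i↮k j↮k
    ik = proj₁ ik×kj
    kj = proj₂ ik×kj
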